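{- Let $n\ge3$ and let $S$ be a strong simple game on an $n$-element voter set $V$ which is a quota game. Then $S$ has weight at most $n-2$.
   Context: A game on $V$ is an upward closed family of subsets of $V$; strong: for every $A\subseteq V$, $A\in S$ or $V\setminus A\in S$; simple: no $A$ has both. A quota game is one for which there exist nonnegative weights $w_v$ ($v\in V$) and a quota $q$ such that $A\in S$ iff $\sum_{v\in A}w_v\ge q$. Weight: with $M_0$ the set of dictatorships $\mathrm{Dict}_x=\{A: x\in A\}$ and $M_k=M_{k-1}\cup\{m(S,T,U): S,T,U\in M_{k-1}\}$, where $m(S,T,U)=(S\cap T)\cup(S\cap U)\cup(T\cap U)$, the weight of a strong simple game is the least $k$ with $S\in M_k$.
   Formalization: The nonnegative weights $w_v$ and the quota $q$ that define a quota game are rational. -}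

module Defs where

open import Data.Nat using (ℕ; zero; suc; _⊔_; _≤_; _∸_)
open import Data.Bool using (Bool; true; false; _∧_; _∨_)
open import Data.Fin using (Fin)
open import Data.Fin.Subset using (Subset; _⊆_; ∁)
open import Data.Vec using (lookup)
open import Data.List using (List; foldr; map)
open import Data.List using () renaming (allFin to allFinL)
open import Data.Rational using (ℚ; 0ℚ; _+_) renaming (_≤_ to _≤ℚ_)
open import Data.Product using (Σ; _×_; ∃)
open import Data.Sum using (_⊎_)
open import Relation.Nullary using (¬_)
open import Relation.Binary.PropositionalEquality using (_≡_)
open import Function.Bundles using (_⇔_)

Family : ℕ → Set
Family n = Subset n → Bool

_∈F_ : ∀ {n} → Subset n → Family n → Set
A ∈F S = S A ≡ true

UpwardClosed : ∀ {n} → Family n → Set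
UpwardClosed {n} S = ∀ (A B : Subset n) → A ⊆ B → A ∈F S → B ∈F S

Strong : ∀ {n} → Family n → Set
Strong {n} S = ∀ (A : Subset n) → A ∈F S ⊎ ∁ A ∈F S

Simple : ∀ {n} → Family n → Set
Simple {n} S = ∀ (A : Subset n) → ¬ (A ∈F S × ∁ A ∈F S)

weightOf : ∀ {n} → (Fin n → ℚ) → Subset n → ℚ
weightOf {n} w A = foldr _+_ 0ℚ (map (λ v → pick (lookup A v) (w v)) (allFinL n))
  where
  pick : Bool → ℚ → ℚ
  pick true x = x
  pick false _ = 0ℚ

QuotaGame : ∀ {n} → Family n → Set
QuotaGame {n} S =
  Σ (Fin n → ℚ) λ w → (∀ v → 0ℚ ≤ℚ w v) ×
    Σ ℚ λ q → ∀ (A : Subset n) → (A ∈F S) ⇔ (q ≤ℚ weightOf w A)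

Dict : ∀ {n} → Fin n → Family n
Dict x A = lookup A x

maj : ∀ {n} → Family n → Family n → Family n → Family n
maj S T U A = (S A ∧ T A) ∨ (S A ∧ U A) ∨ (T A ∧ U A)

data MajExpr (n : ℕ) : Set where
  dict : Fin n → MajExpr n
  med  : MajExpr n → MajExpr n → MajExpr n → MajExpr n

depth : ∀ {n} → MajExpr n → ℕ
depth (dict _) = 0
depth (med a b c) = suc (depth a ⊔ depth b ⊔ depth c)

eval : ∀ {n} → MajExpr n → Family n
eval (dict x) = Dict x
eval (med a b c) = maj (eval a) (eval b) (eval c)

-- S ∈ M_k : S equals (as a family of coalitions) some median expression of depth ≤ k.
-- (This is exactly the cumulative hierarchy M_0 ⊆ M_1 ⊆ ... of the paper.)
InM : ∀ {n} → ℕ → Family n → Set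
InM {n} k S = Σ (MajExpr n) λ e → (depth e ≤ k) × (∀ (A : Subset n) → eval e A ≡ S A)

-- weight of S is at most k  iff  S ∈ M_k (the M_k are increasing)
WeightAtMost : ∀ {n} → Family n → ℕ → Set
WeightAtMost S k = InM k S

{-# OPTIONS --safe #-}
-- Only upward closure (monotonicity) and strong + simple (self-duality) are
-- used.  For a monotone f of at least three
-- variables, f = m(f[x₀≔x₁], f[x₁≔x₂], f[x₂≔x₀]): at least two of the cyclic
-- comparisons x₀ ≤ x₁, x₁ ≤ x₂, x₂ ≤ x₀ hold, and likewise for ≥, so at least
-- two of the three restrictions lie above f(x) and at least two below.  Each
-- restriction is a monotone self-dual function of one variable fewer, and on at
-- most two variables a monotone self-dual function is a dictatorship, so
-- induction on the number of variables gives depth n − 2.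
module Submission where

open import Defs
open import Data.Bool.Base as Bool using (Bool; true; false; not; _∧_; _∨_; b≤b; f≤t)
open import Data.Bool.Properties using (≤-minimum; ≤-maximum; ≤-refl; ≤-reflexive; ≤-antisym; ∨-zeroʳ; ∧-zeroʳ; ¬-not; not-¬)
open import Data.Empty using (⊥-elim)
open import Data.Fin.Base using (Fin; punchIn; punchOut)
open import Data.Fin.Patterns using (0F; 1F; 2F)
open import Data.Fin.Properties using (_≟_; punchIn-punchOut)
open import Data.Fin.Subset using (_⊆_; ∁)
open import Data.Nat.Base using (ℕ; suc; _+_; _≤_; _∸_; z≤n; s≤s)
open import Data.Nat.Properties using (⊔-lub)
open import Data.Product.Base using (Σ-syntax; _×_; _,_)
open import Data.Sum.Base using (_⊎_; inj₁; inj₂)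
open import Data.Vec.Functional using (Vector; toVec; fromVec; insertAt)
open import Data.Vec.Functional.Properties using (insertAt-lookup; insertAt-punchIn; toVec∘fromVec)
open import Data.Vec.Functional.Relation.Binary.Pointwise using (Pointwise)
open import Data.Vec.Properties using (lookup∘tabulate; tabulate-∘; []=⇒lookup; lookup⇒[]=)
open import Function.Base using (_∘_; flip)
open import Relation.Binary.Definitions using (Reflexive)
open import Relation.Binary.PropositionalEquality using (_≡_; _≢_; _≗_; refl; sym; trans; cong; subst; module ≡-Reasoning)
open import Relation.Nullary.Decidable using (yes; no; does)
open import Relation.Nullary.Negation.Core using (¬_)

private
  variable
    k n : ℕ

majority : Bool → Bool → Bool → Bool
majority a b c = (a ∧ b) ∨ (a ∧ c) ∨ (b ∧ c)

majority-cong : ∀ {a a′ b b′ c c′} → a ≡ a′ → b ≡ b′ → c ≡ c′ → majority a b c ≡ majority a′ b′ c′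
majority-cong refl refl refl = refl

TwoOf : Set → Set → Set → Set
TwoOf P Q R = P × Q ⊎ P × R ⊎ Q × R

TwoOf-map : ∀ {P Q R P′ Q′ R′ : Set} → (P → P′) → (Q → Q′) → (R → R′) → TwoOf P Q R → TwoOf P′ Q′ R′
TwoOf-map f g h (inj₁ (p , q))        = inj₁ (f p , g q)
TwoOf-map f g h (inj₂ (inj₁ (p , r))) = inj₂ (inj₁ (f p , h r))
TwoOf-map f g h (inj₂ (inj₂ (q , r))) = inj₂ (inj₂ (g q , h r))

TwoOf-swap : ∀ {P Q R : Set} → TwoOf P Q R → TwoOf Q P R
TwoOf-swap (inj₁ (p , q))        = inj₁ (q , p)
TwoOf-swap (inj₂ (inj₁ (p , r))) = inj₂ (inj₂ (p , r))
TwoOf-swap (inj₂ (inj₂ (q , r))) = inj₂ (inj₁ (q , r))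

≤-cyclic : ∀ p q r → TwoOf (p Bool.≤ q) (q Bool.≤ r) (r Bool.≤ p)
≤-cyclic false false r     = inj₁ (b≤b , ≤-minimum r)
≤-cyclic false true  false = inj₂ (inj₁ (f≤t , b≤b))
≤-cyclic false true  true  = inj₁ (f≤t , b≤b)
≤-cyclic true  false false = inj₂ (inj₂ (b≤b , f≤t))
≤-cyclic true  false true  = inj₂ (inj₂ (f≤t , b≤b))
≤-cyclic true  true  r     = inj₂ (inj₁ (b≤b , ≤-maximum r))

majority-≡ : ∀ x {a b c} → TwoOf (x Bool.≤ a) (x Bool.≤ b) (x Bool.≤ c) →
             TwoOf (a Bool.≤ x) (b Bool.≤ x) (c Bool.≤ x) → majority a b c ≡ x
majority-≡ true          (inj₁ (b≤b , b≤b))        _ = refl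
majority-≡ true {b = b}  (inj₂ (inj₁ (b≤b , b≤b))) _ = ∨-zeroʳ b
majority-≡ true {false}  (inj₂ (inj₂ (b≤b , b≤b))) _ = refl
majority-≡ true {true}   (inj₂ (inj₂ (b≤b , b≤b))) _ = refl
majority-≡ false         _ (inj₁ (b≤b , b≤b))        = refl
majority-≡ false {b = b} _ (inj₂ (inj₁ (b≤b , b≤b))) = ∧-zeroʳ b
majority-≡ false {false} _ (inj₂ (inj₂ (b≤b , b≤b))) = refl
majority-≡ false {true}  _ (inj₂ (inj₂ (b≤b , b≤b))) = refl

≤-true : ∀ {a b} → a Bool.≤ b → a ≡ true → b ≡ true
≤-true b≤b a≡true = a≡true

≤-false : ∀ {a b} → a Bool.≤ b → b ≡ false → a ≡ false
≤-false b≤b b≡false = b≡false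

⇒-≤ : ∀ {a b} → (a ≡ true → b ≡ true) → a Bool.≤ b
⇒-≤ {false} _ = ≤-minimum _
⇒-≤ {true}  a⇒b rewrite a⇒b refl = b≤b

BoolFun : ℕ → Set
BoolFun n = Vector Bool n → Bool

Monotone : BoolFun n → Set
Monotone f = ∀ {x y} → Pointwise Bool._≤_ x y → f x Bool.≤ f y

SelfDual : BoolFun n → Set
SelfDual f = ∀ x → f (not ∘ x) ≡ not (f x)

monotone-resp-≗ : {f : BoolFun n} → Monotone f → ∀ {x y} → x ≗ y → f x ≡ f y
monotone-resp-≗ mono x≗y = ≤-antisym (mono (≤-reflexive ∘ x≗y)) (mono (≤-reflexive ∘ sym ∘ x≗y))

monotone-∘ : {f : BoolFun n} (σ : Fin n → Fin k) → Monotone f → Monotone (λ z → f (z ∘ σ))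
monotone-∘ σ mono x≤y = mono (x≤y ∘ σ)

selfDual-∘ : {f : BoolFun n} (σ : Fin n → Fin k) → SelfDual f → SelfDual (λ z → f (z ∘ σ))
selfDual-∘ σ selfDual x = selfDual (x ∘ σ)

monotone-selfDual-true : {f : BoolFun n} → Monotone f → SelfDual f → f (λ _ → true) ≡ true
monotone-selfDual-true {f = f} mono selfDual =
  not-≤-self (subst (Bool._≤ f (λ _ → true)) (selfDual _) (mono (λ _ → f≤t)))
  where
  not-≤-self : ∀ {b} → not b Bool.≤ b → b ≡ true
  not-≤-self {false} ()
  not-≤-self {true}  _ = refl

monotone-selfDual-nullary : {f : BoolFun 0} → Monotone f → ¬ SelfDual f
monotone-selfDual-nullary mono selfDual =
  not-¬ refl (trans (monotone-resp-≗ mono (λ ())) (selfDual y))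
  where
  y : Vector Bool 0
  y ()

indicator : Fin n → Vector Bool n
indicator i j = does (i ≟ j)

indicator-≤ : ∀ {y : Vector Bool n} i → y i ≡ true → Pointwise Bool._≤_ (indicator i) y
indicator-≤ i yi≡true j with i ≟ j
... | yes refl = ≤-reflexive (sym yi≡true)
... | no _     = ≤-minimum _

≤-not∘indicator : ∀ {y : Vector Bool n} i → y i ≡ false → Pointwise Bool._≤_ y (not ∘ indicator i)
≤-not∘indicator i yi≡false j with i ≟ j
... | yes refl = ≤-reflexive yi≡false
... | no _     = ≤-maximum _

dictator : {f : BoolFun n} → Monotone f → SelfDual f → ∀ i → f (indicator i) ≡ true → (λ y → y i) ≗ f
dictator mono selfDual i fi≡true y with y i in yi
... | true  = sym (≤-true (mono (indicator-≤ i yi)) fi≡true)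
... | false = sym (≤-false (mono (≤-not∘indicator i yi)) (trans (selfDual _) (cong not fi≡true)))

-- identify sends i to j and fixes every other index, so y ∘ identify is y with
-- x_i replaced by x_j; it factors through merge, which forgets index i.
module _ {i j : Fin (suc n)} (i≢j : i ≢ j) where

  merge : Fin (suc n) → Fin n
  merge = insertAt (λ v → v) i (punchOut i≢j)

  identify : Fin (suc n) → Fin (suc n)
  identify = punchIn i ∘ merge

  identify-source : identify i ≡ j
  identify-source = trans (cong (punchIn i) (insertAt-lookup _ i _)) (punchIn-punchOut i≢j)

  identify-other : ∀ {v} → i ≢ v → identify v ≡ v
  identify-other {v} i≢v = begin
    identify v                          ≡⟨ cong identify (punchIn-punchOut i≢v) ⟨
    identify (punchIn i (punchOut i≢v)) ≡⟨ cong (punchIn i) (insertAt-punchIn _ i _ _) ⟩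
    punchIn i (punchOut i≢v)            ≡⟨ punchIn-punchOut i≢v ⟩
    v                                   ∎
    where open ≡-Reasoning

  pointwise-∘identify : {R : Bool → Bool → Set} → Reflexive R →
                        ∀ {y : Vector Bool (suc n)} → R (y i) (y j) → Pointwise R y (y ∘ identify)
  pointwise-∘identify {R} R-refl {y} r v with i ≟ v
  ... | yes refl = subst (R (y i)) (cong y (sym identify-source)) r
  ... | no i≢v   = subst (R (y v)) (cong y (sym (identify-other i≢v))) R-refl

median-decomposition : {f : BoolFun (suc n)} → Monotone f →
                       ∀ {i j l} (i≢j : i ≢ j) (j≢l : j ≢ l) (l≢i : l ≢ i) y →
                       majority (f (y ∘ identify i≢j)) (f (y ∘ identify j≢l)) (f (y ∘ identify l≢i)) ≡ f y
median-decomposition {f = f} mono {i} {j} {l} i≢j j≢l l≢i y = majority-≡ (f y)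
  (TwoOf-map (above i≢j) (above j≢l) (above l≢i) (≤-cyclic (y i) (y j) (y l)))
  (TwoOf-map (below i≢j) (below j≢l) (below l≢i) (TwoOf-swap (≤-cyclic (y l) (y j) (y i))))
  where
  above : ∀ {a b} (a≢b : a ≢ b) → y a Bool.≤ y b → f y Bool.≤ f (y ∘ identify a≢b)
  above a≢b = mono ∘ pointwise-∘identify a≢b {R = Bool._≤_} ≤-refl

  below : ∀ {a b} (a≢b : a ≢ b) → y b Bool.≤ y a → f (y ∘ identify a≢b) Bool.≤ f y
  below a≢b = mono ∘ pointwise-∘identify a≢b {R = flip Bool._≤_} ≤-refl

⟦_⟧ : MajExpr n → BoolFun n
⟦ dict i ⟧    y = y i
⟦ med a b c ⟧ y = majority (⟦ a ⟧ y) (⟦ b ⟧ y) (⟦ c ⟧ y)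

eval-⟦⟧ : ∀ (e : MajExpr n) A → eval e A ≡ ⟦ e ⟧ (fromVec A)
eval-⟦⟧ (dict i)    A = refl
eval-⟦⟧ (med a b c) A = majority-cong (eval-⟦⟧ a A) (eval-⟦⟧ b A) (eval-⟦⟧ c A)

rename : (Fin k → Fin n) → MajExpr k → MajExpr n
rename τ (dict i)    = dict (τ i)
rename τ (med a b c) = med (rename τ a) (rename τ b) (rename τ c)

⟦rename⟧ : ∀ (τ : Fin k → Fin n) e y → ⟦ rename τ e ⟧ y ≡ ⟦ e ⟧ (y ∘ τ)
⟦rename⟧ τ (dict i)    y = refl
⟦rename⟧ τ (med a b c) y = majority-cong (⟦rename⟧ τ a y) (⟦rename⟧ τ b y) (⟦rename⟧ τ c y)

depth-rename : ∀ (τ : Fin k → Fin n) e → depth (rename τ e) ≡ depth e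
depth-rename τ (dict i)    = refl
depth-rename τ (med a b c) rewrite depth-rename τ a | depth-rename τ b | depth-rename τ c = refl

Expressible : ℕ → BoolFun n → Set
Expressible {n} d f = Σ[ e ∈ MajExpr n ] depth e ≤ d × ⟦ e ⟧ ≗ f

expressible-resp-≗ : ∀ {d} {f g : BoolFun n} → f ≗ g → Expressible d f → Expressible d g
expressible-resp-≗ f≗g (e , e≤d , ⟦e⟧≗f) = e , e≤d , λ y → trans (⟦e⟧≗f y) (f≗g y)

expressible-∘ : ∀ {d} {g : BoolFun k} (τ : Fin k → Fin n) → Expressible d g → Expressible d (λ y → g (y ∘ τ))
expressible-∘ {d = d} τ (e , e≤d , ⟦e⟧≗g) =
  rename τ e , subst (_≤ d) (sym (depth-rename τ e)) e≤d , λ y → trans (⟦rename⟧ τ e y) (⟦e⟧≗g (y ∘ τ))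

expressible-majority : ∀ {d} {f g h : BoolFun n} → Expressible d f → Expressible d g → Expressible d h →
                       Expressible (suc d) (λ y → majority (f y) (g y) (h y))
expressible-majority (a , a≤d , ⟦a⟧≗f) (b , b≤d , ⟦b⟧≗g) (c , c≤d , ⟦c⟧≗h) =
  med a b c , s≤s (⊔-lub (⊔-lub a≤d b≤d) c≤d) , λ y → majority-cong (⟦a⟧≗f y) (⟦b⟧≗g y) (⟦c⟧≗h y)

monotone-selfDual⇒expressible-suc :
  ∀ {m} → (∀ {g : BoolFun (2 + m)} → Monotone g → SelfDual g → Expressible m g) →
  ∀ {f : BoolFun (3 + m)} → Monotone f → SelfDual f → Expressible (suc m) f
monotone-selfDual⇒expressible-suc {m} expressible {f} mono selfDual =
  expressible-resp-≗ (median-decomposition mono 0≢1 1≢2 2≢0)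
    (expressible-majority (restriction 0≢1) (restriction 1≢2) (restriction 2≢0))
  where
  restriction : ∀ {i j} (i≢j : i ≢ j) → Expressible m (λ y → f (y ∘ identify i≢j))
  restriction {i} i≢j = expressible-∘ (punchIn i)
    (expressible (monotone-∘ (merge i≢j) mono) (selfDual-∘ (merge i≢j) selfDual))

  0≢1 : _≢_ {A = Fin (3 + m)} 0F 1F
  0≢1 ()
  1≢2 : _≢_ {A = Fin (3 + m)} 1F 2F
  1≢2 ()
  2≢0 : _≢_ {A = Fin (3 + m)} 2F 0F
  2≢0 ()

monotone-selfDual⇒expressible : ∀ k {f : BoolFun k} → Monotone f → SelfDual f → Expressible (k ∸ 2) f
monotone-selfDual⇒expressible 0 mono selfDual = ⊥-elim (monotone-selfDual-nullary mono selfDual)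
monotone-selfDual⇒expressible 1 mono selfDual =
  dict 0F , z≤n , dictator mono selfDual 0F
    (trans (monotone-resp-≗ mono λ { 0F → refl }) (monotone-selfDual-true mono selfDual))
monotone-selfDual⇒expressible 2 {f} mono selfDual with f (indicator 0F) in f0≡
... | true  = dict 0F , z≤n , dictator mono selfDual 0F f0≡
... | false = dict 1F , z≤n , dictator mono selfDual 1F (begin
  f (indicator 1F)         ≡⟨ monotone-resp-≗ mono (λ { 0F → refl ; 1F → refl }) ⟩
  f (not ∘ indicator 0F)   ≡⟨ selfDual _ ⟩
  not (f (indicator 0F))   ≡⟨ cong not f0≡ ⟩
  true                     ∎)
  where open ≡-Reasoning
monotone-selfDual⇒expressible (suc (suc (suc m))) =
  monotone-selfDual⇒expressible-suc (monotone-selfDual⇒expressible (suc (suc m)))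

upwardClosed⇒monotone : {S : Family n} → UpwardClosed S → Monotone (S ∘ toVec)
upwardClosed⇒monotone up {x} {y} x≤y = ⇒-≤ (up (toVec x) (toVec y) toVec-mono)
  where
  toVec-mono : toVec x ⊆ toVec y
  toVec-mono {v} v∈x = lookup⇒[]= v (toVec y) (trans (lookup∘tabulate y v)
    (≤-true (x≤y v) (trans (sym (lookup∘tabulate x v)) ([]=⇒lookup v∈x))))

strong-simple⇒∁ : {S : Family n} → Strong S → Simple S → ∀ A → S (∁ A) ≡ not (S A)
strong-simple⇒∁ strong simple A with strong A
... | inj₁ A∈S  = trans (¬-not λ ∁A∈S → simple A (A∈S , ∁A∈S)) (cong not (sym A∈S))
... | inj₂ ∁A∈S = trans ∁A∈S (cong not (sym (¬-not λ A∈S → simple A (A∈S , ∁A∈S))))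

strong-simple⇒selfDual : {S : Family n} → Strong S → Simple S → SelfDual (S ∘ toVec)
strong-simple⇒selfDual {S = S} strong simple x =
  trans (cong S (tabulate-∘ not x)) (strong-simple⇒∁ strong simple (toVec x))

expressible⇒weightAtMost : ∀ {d} {S : Family n} → Expressible d (S ∘ toVec) → WeightAtMost S d
expressible⇒weightAtMost {S = S} (e , e≤d , ⟦e⟧≗S) = e , e≤d , λ A → begin
  eval e A               ≡⟨ eval-⟦⟧ e A ⟩
  ⟦ e ⟧ (fromVec A)      ≡⟨ ⟦e⟧≗S (fromVec A) ⟩
  S (toVec (fromVec A))  ≡⟨ cong S (toVec∘fromVec A) ⟩
  S A                    ∎
  where open ≡-Reasoning

corollary2 : ∀ (n : ℕ) → 3 ≤ n → (S : Family n) →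
    UpwardClosed S → Strong S → Simple S → QuotaGame S →
    WeightAtMost S (n ∸ 2)
corollary2 n _ S up strong simple _ = expressible⇒weightAtMost
  (monotone-selfDual⇒expressible n (upwardClosed⇒monotone up) (strong-simple⇒selfDual strong simple))
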